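{- Let $A$ be a pseudo $BL$-algebra and let $F$ be an interval valued $(\in,\in\!\vee q)$-fuzzy filter of $A$ such that $\widehat{\mu_F}(x\rightarrow y)=\widehat{\mu_F}(x\hookrightarrow y)$ for all $x,y\in A$. Then the following are equivalent: (1) $F$ is an interval valued $(\in,\in\!\vee q)$-fuzzy implicative filter of $A$; (2) $F$ is both an interval valued $(\in,\in\!\vee q)$-fuzzy $MV$-filter and an interval valued $(\in,\in\!\vee q)$-fuzzy $G$-filter of $A$.
   Context: A pseudo $BL$-algebra is an algebra $(A;\wedge,\vee,\odot,\rightarrow,\hookrightarrow,0,1)$ of type $(2,2,2,2,2,0,0)$ such that $(A,\wedge,\vee,0,1)$ is a bounded lattice with lattice order $\le$, $(A,\odot,1)$ is a monoid, and for all $x,y,z\in A$: (a1) $x\odot y\le z\iff x\le y\rightarrow z\iff y\le x\hookrightarrow z$; (a2) $x\wedge y=(x\rightarrow y)\odot x=x\odot(x\hookrightarrow y)$; (a3) $(x\rightarrow y)\vee(y\rightarrow x)=(x\hookrightarrow y)\vee(y\hookrightarrow x)=1$. An interval number is $\widehat{a}=[a^{\bot},a^{\top}]$ with $0\le a^{\bot}\le a^{\top}\le 1$; $D[0,1]$ is the set of interval numbers. $\widehat{a}\le\widehat{b}$ iff $a^{\bot}\le b^{\bot}$ and $a^{\top}\le b^{\top}$; $\widehat{a}<\widehat{b}$ iff $\widehat{a}\le\widehat{b}$ and $\widehat{a}\ne\widehat{b}$; $\mathrm{rmin},\mathrm{rmax}$ and sums are componentwise. An interval valued fuzzy set $F$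 of $A$ is a map $\widehat{\mu_F}:A\to D[0,1]$; standing assumption: for every $x\in A$, either $\widehat{\mu_F}(x)<[0.5,0.5]$ or $[0.5,0.5]\le\widehat{\mu_F}(x)$. For $x\in A$ and nonzero $\widehat t\in D[0,1]$: $U(x;\widehat t)\in F$ means $\widehat{\mu_F}(x)\ge\widehat t$; $U(x;\widehat t)\,q\,F$ means $\widehat{\mu_F}(x)+\widehat t>[1,1]$; $U(x;\widehat t)\in\!\vee q\,F$ means one of these holds. $F$ is an interval valued $(\in,\in\!\vee q)$-fuzzy filter if for all nonzero $\widehat t,\widehat r\in D[0,1]$ and $x,y\in A$: (F3) $U(x;\widehat t)\in F$ and $U(y;\widehat r)\in F$ imply $U(x\odot y;\mathrm{rmin}\{\widehat t,\widehat r\})\in\!\vee q\,F$; (F4) if $x\le y$ and $U(x;\widehat r)\in F$ then $U(y;\widehat r)\in\!\vee q\,F$. Such an $F$ is called, respectively: - an interval valued $(\in,\in\!\vee q)$-fuzzy implicative filter if for all $x,y$: $\widehat{\mu_F}(x)\ge\mathrm{rmin}\{\widehat{\mu_F}((x\rightarrow y)\hookrightarrow x),[0.5,0.5]\}$ and $\widehat{\mu_F}(x)\ge\mathrm{rmin}\{\widehat{\mu_F}((x\hookrightarrow y)\rightarrow x),[0.5,0.5]\}$; - an interval valued $(\in,\in\!\vee q)$-fuzzy $MV$-filter if for all $x,y$: $\widehat{\mu_F}(((y\rightarrow x)\hookrightarrow x)\rightarrow y)\ge\mathrm{rmin}\{\widehat{\mu_F}(x\rightarrow y),[0.5,0.5]\}$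 and $\widehat{\mu_F}(((y\hookrightarrow x)\rightarrow x)\hookrightarrow y)\ge\mathrm{rmin}\{\widehat{\mu_F}(x\hookrightarrow y),[0.5,0.5]\}$; - an interval valued $(\in,\in\!\vee q)$-fuzzy $G$-filter if for all $x,y$: $\widehat{\mu_F}(x\rightarrow y)\ge\mathrm{rmin}\{\widehat{\mu_F}(x\rightarrow(x\rightarrow y)),[0.5,0.5]\}$ and $\widehat{\mu_F}(x\hookrightarrow y)\ge\mathrm{rmin}\{\widehat{\mu_F}(x\hookrightarrow(x\hookrightarrow y)),[0.5,0.5]\}$. -}

module Defs where

open import Data.Product using (Σ; ∃; _×_; _,_)
open import Data.Sum using (_⊎_)
open import Relation.Nullary using (¬_; does)
open import Relation.Binary.Definitions using (Decidable)
open import Relation.Binary.PropositionalEquality using (_≡_)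
open import Algebra.Structures using (IsCommutativeRing; IsMonoid)
open import Algebra.Lattice.Structures using (IsLattice)
open import Data.Bool using (if_then_else_)

-- The real numbers, axiomatised as a complete (Dedekind-complete)
-- linearly ordered field. Any model is (classically) isomorphic to ℝ.
-- Decidability of ≤ is included (classically valid for ℝ).

record RealField : Set₁ where
  infixl 6 _+_
  infixl 7 _*_
  infix 4 _≤_
  field
    ℝ : Set
    0ℝ 1ℝ ½ : ℝ
    _+_ _*_ : ℝ → ℝ → ℝ
    -_ : ℝ → ℝ
    _≤_ : ℝ → ℝ → Set
    isCommutativeRing : IsCommutativeRing _≡_ _+_ _*_ -_ 0ℝ 1ℝ
    0≢1 : ¬ (0ℝ ≡ 1ℝ)
    inverse : ∀ x → ¬ (x ≡ 0ℝ) → ∃ λ y → x * y ≡ 1ℝ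
    ≤-refl : ∀ x → x ≤ x
    ≤-trans : ∀ {x y z} → x ≤ y → y ≤ z → x ≤ z
    ≤-antisym : ∀ {x y} → x ≤ y → y ≤ x → x ≡ y
    ≤-total : ∀ x y → x ≤ y ⊎ y ≤ x
    _≤?_ : Decidable _≤_
    +-mono-≤ : ∀ {x y} z → x ≤ y → x + z ≤ y + z
    *-nonneg : ∀ {x y} → 0ℝ ≤ x → 0ℝ ≤ y → 0ℝ ≤ x * y
    complete : (S : ℝ → Set) → (∃ λ x → S x) → (∃ λ b → ∀ x → S x → x ≤ b) →
               ∃ λ s → (∀ x → S x → x ≤ s) × (∀ b → (∀ x → S x → x ≤ b) → s ≤ b)
    ½+½ : ½ + ½ ≡ 1ℝ

record PseudoBL : Set₁ where
  infixr 5 _⇒_ _↪_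
  infixl 7 _⊙_
  infixl 6 _∧_ _∨_
  infix 4 _≤_
  field
    Carrier : Set
    _∧_ _∨_ _⊙_ _⇒_ _↪_ : Carrier → Carrier → Carrier
    𝟎 𝟏 : Carrier
    isLattice : IsLattice _≡_ _∨_ _∧_
    isMonoid  : IsMonoid _≡_ _⊙_ 𝟏

  _≤_ : Carrier → Carrier → Set
  x ≤ y = x ∧ y ≡ x

  field
    bottom : ∀ x → 𝟎 ≤ x
    top    : ∀ x → x ≤ 𝟏
    a1-⇒ : ∀ x y z → (x ⊙ y ≤ z → x ≤ y ⇒ z) × (x ≤ y ⇒ z → x ⊙ y ≤ z)
    a1-↪ : ∀ x y z → (x ⊙ y ≤ z → y ≤ x ↪ z) × (y ≤ x ↪ z → x ⊙ y ≤ z)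
    a2-⇒ : ∀ x y → x ∧ y ≡ (x ⇒ y) ⊙ x
    a2-↪ : ∀ x y → x ∧ y ≡ x ⊙ (x ↪ y)
    a3-⇒ : ∀ x y → (x ⇒ y) ∨ (y ⇒ x) ≡ 𝟏
    a3-↪ : ∀ x y → (x ↪ y) ∨ (y ↪ x) ≡ 𝟏

module Interval (R : RealField) where
  open RealField R

  -- a pair of reals [lo , hi]; interval numbers are those satisfying InD
  record IPair : Set where
    constructor [_,_]
    field
      lo hi : ℝ
  open IPair public

  InD : IPair → Set
  InD a = (0ℝ ≤ lo a) × (lo a ≤ hi a) × (hi a ≤ 1ℝ)

  infix 4 _≤ᵢ_ _<ᵢ_ _≐ᵢ_
  _≤ᵢ_ : IPair → IPair → Set
  a ≤ᵢ b = (lo a ≤ lo b) × (hi a ≤ hi b)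

  _≐ᵢ_ : IPair → IPair → Set
  a ≐ᵢ b = (lo a ≡ lo b) × (hi a ≡ hi b)

  _<ᵢ_ : IPair → IPair → Set
  a <ᵢ b = a ≤ᵢ b × ¬ (a ≐ᵢ b)

  min : ℝ → ℝ → ℝ
  min x y = if does (x ≤? y) then x else y

  rmin : IPair → IPair → IPair
  rmin a b = [ min (lo a) (lo b) , min (hi a) (hi b) ]

  _+ᵢ_ : IPair → IPair → IPair
  a +ᵢ b = [ lo a + lo b , hi a + hi b ]

  𝟘ᵢ 𝟙ᵢ ½ᵢ : IPair
  𝟘ᵢ = [ 0ℝ , 0ℝ ]
  𝟙ᵢ = [ 1ℝ , 1ℝ ]
  ½ᵢ = [ ½ , ½ ]

  NonZero : IPair → Set
  NonZero t = ¬ (t ≐ᵢ 𝟘ᵢ)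

module Fuzzy (R : RealField) (A : PseudoBL) where
  open Interval R public
  open PseudoBL A

  ValuedInD : (Carrier → IPair) → Set
  ValuedInD μ = ∀ x → InD (μ x)

  Standing : (Carrier → IPair) → Set
  Standing μ = ∀ x → (μ x <ᵢ ½ᵢ) ⊎ (½ᵢ ≤ᵢ μ x)

  ∈F : (Carrier → IPair) → Carrier → IPair → Set
  ∈F μ x t = t ≤ᵢ μ x

  qF : (Carrier → IPair) → Carrier → IPair → Set
  qF μ x t = 𝟙ᵢ <ᵢ μ x +ᵢ t

  ∈∨qF : (Carrier → IPair) → Carrier → IPair → Set
  ∈∨qF μ x t = ∈F μ x t ⊎ qF μ x t

  IsFilter : (Carrier → IPair) → Set
  IsFilter μ =
    (∀ t r x y → InD t → InD r → NonZero t → NonZero r →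
       ∈F μ x t → ∈F μ y r → ∈∨qF μ (x ⊙ y) (rmin t r))
    × (∀ r x y → InD r → NonZero r → x ≤ y → ∈F μ x r → ∈∨qF μ y r)

  IsImplicative : (Carrier → IPair) → Set
  IsImplicative μ = ∀ x y →
    (rmin (μ ((x ⇒ y) ↪ x)) ½ᵢ ≤ᵢ μ x) × (rmin (μ ((x ↪ y) ⇒ x)) ½ᵢ ≤ᵢ μ x)

  IsMV : (Carrier → IPair) → Set
  IsMV μ = ∀ x y →
    (rmin (μ (x ⇒ y)) ½ᵢ ≤ᵢ μ (((y ⇒ x) ↪ x) ⇒ y))
    × (rmin (μ (x ↪ y)) ½ᵢ ≤ᵢ μ (((y ↪ x) ⇒ x) ↪ y))

  IsG : (Carrier → IPair) → Set
  IsG μ = ∀ x y →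
    (rmin (μ (x ⇒ (x ⇒ y))) ½ᵢ ≤ᵢ μ (x ⇒ y))
    × (rmin (μ (x ↪ (x ↪ y))) ½ᵢ ≤ᵢ μ (x ↪ y))

-- For an interval t ∈ D[0,1] with t ≤ [0.5,0.5], the cut {x | t ≤ μ x} is
-- a crisp filter: a quasi-coincidence U(x;t) q F with t ≤ [0.5,0.5] already
-- forces t ≤ μ x. Moreover rmin(μ a, [0.5,0.5]) ≤ μ b holds exactly when
-- every such cut containing a contains b. Since μ(x → y) = μ(x ↪ y), every
-- cut is closed under exchanging the two residuals, and the theorem reduces
-- to its crisp counterpart: such a filter is implicative iff it is an MV- and
-- a G-filter, which only uses residuation in an integral monoid.

module Submission where

open import Defs
open import Data.Product using (_×_; _,_; proj₁; proj₂)
open import Data.Sum using (_⊎_; inj₁; inj₂)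
open import Data.Empty using (⊥-elim)
open import Relation.Nullary using (yes; no)
open import Relation.Binary.PropositionalEquality
  using (_≡_; refl; sym; trans; cong₂; subst; subst₂)
open import Relation.Binary.Bundles using (Poset)
open import Function.Bundles using (_⇔_; mk⇔; Equivalence)
open import Algebra.Structures using (IsMonoid; IsCommutativeRing)
open import Algebra.Bundles using (Ring)
open import Algebra.Lattice.Bundles using (Lattice)
import Algebra.Properties.Ring as RingProperties
import Algebra.Lattice.Properties.Lattice as LatticeProperties

record ResiduatedMonoid : Set₁ where
  infixr 5 _⇒_ _↪_
  infixl 7 _⊙_
  infix 4 _≤_
  field
    Carrier : Set
    _≤_ : Carrier → Carrier → Set
    _⊙_ _⇒_ _↪_ : Carrier → Carrier → Carrier
    𝟏 : Carrier
    ≤-refl : ∀ x → x ≤ x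
    ≤-trans : ∀ {x y z} → x ≤ y → y ≤ z → x ≤ z
    ≤-𝟏 : ∀ x → x ≤ 𝟏
    identityˡ : ∀ x → 𝟏 ⊙ x ≡ x
    identityʳ : ∀ x → x ⊙ 𝟏 ≡ x
    assoc : ∀ x y z → (x ⊙ y) ⊙ z ≡ x ⊙ (y ⊙ z)
    ⇒-intro : ∀ x y z → x ⊙ y ≤ z → x ≤ y ⇒ z
    ⇒-elim : ∀ x y z → x ≤ y ⇒ z → x ⊙ y ≤ z
    ↪-intro : ∀ x y z → x ⊙ y ≤ z → y ≤ x ↪ z
    ↪-elim : ∀ x y z → y ≤ x ↪ z → x ⊙ y ≤ z

op : ResiduatedMonoid → ResiduatedMonoid
op M = record
  { Carrier = Carrier ; _≤_ = _≤_ ; _⊙_ = λ x y → y ⊙ x ; _⇒_ = _↪_ ; _↪_ = _⇒_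
  ; 𝟏 = 𝟏 ; ≤-refl = ≤-refl ; ≤-trans = ≤-trans ; ≤-𝟏 = ≤-𝟏
  ; identityˡ = identityʳ ; identityʳ = identityˡ
  ; assoc = λ x y z → sym (assoc z y x)
  ; ⇒-intro = λ x y z → ↪-intro y x z ; ⇒-elim = λ x y z → ↪-elim y x z
  ; ↪-intro = λ x y z → ⇒-intro y x z ; ↪-elim = λ x y z → ⇒-elim y x z
  }
  where open ResiduatedMonoid M

residuatedMonoid : PseudoBL → ResiduatedMonoid
residuatedMonoid A = record
  { Carrier = Carrier ; _≤_ = _≤_ ; _⊙_ = _⊙_ ; _⇒_ = _⇒_ ; _↪_ = _↪_ ; 𝟏 = 𝟏
  ; ≤-refl = ∧-idem
  ; ≤-trans = λ p q → sym (Poset.trans poset (sym p) (sym q))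
  ; ≤-𝟏 = top
  ; identityˡ = proj₁ (IsMonoid.identity isMonoid)
  ; identityʳ = proj₂ (IsMonoid.identity isMonoid)
  ; assoc = IsMonoid.assoc isMonoid
  ; ⇒-intro = λ x y z → proj₁ (a1-⇒ x y z) ; ⇒-elim = λ x y z → proj₂ (a1-⇒ x y z)
  ; ↪-intro = λ x y z → proj₁ (a1-↪ x y z) ; ↪-elim = λ x y z → proj₂ (a1-↪ x y z)
  }
  where
  open PseudoBL A
  lattice : Lattice _ _
  lattice = record { isLattice = isLattice }
  open LatticeProperties lattice using (∧-idem; poset)

module ResiduatedMonoidProperties (M : ResiduatedMonoid) where
  open ResiduatedMonoid M

  ⇒-eval : ∀ x y → (x ⇒ y) ⊙ x ≤ y
  ⇒-eval x y = ⇒-elim (x ⇒ y) x y (≤-refl _)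

  ↪-eval : ∀ x y → x ⊙ (x ↪ y) ≤ y
  ↪-eval x y = ↪-elim x (x ↪ y) y (≤-refl _)

  ⊙-monoʳ : ∀ z {x y} → x ≤ y → z ⊙ x ≤ z ⊙ y
  ⊙-monoʳ z {x} {y} x≤y = ↪-elim z x (z ⊙ y) (≤-trans x≤y (↪-intro z y _ (≤-refl _)))

  ⊙-monoˡ : ∀ z {x y} → x ≤ y → x ⊙ z ≤ y ⊙ z
  ⊙-monoˡ z {x} {y} x≤y = ⇒-elim x z (y ⊙ z) (≤-trans x≤y (⇒-intro y z _ (≤-refl _)))

  ≤-⇒ : ∀ x y → y ≤ x ⇒ y
  ≤-⇒ x y = ⇒-intro y x y (subst (y ⊙ x ≤_) (identityʳ y) (⊙-monoʳ y (≤-𝟏 x)))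

  ⇒-antitoneˡ : ∀ z {x y} → x ≤ y → y ⇒ z ≤ x ⇒ z
  ⇒-antitoneˡ z {x} {y} x≤y = ⇒-intro _ x z (≤-trans (⊙-monoʳ (y ⇒ z) x≤y) (⇒-eval y z))

  ↪-antitoneˡ : ∀ z {x y} → x ≤ y → y ↪ z ≤ x ↪ z
  ↪-antitoneˡ z {x} {y} x≤y = ↪-intro x _ z (≤-trans (⊙-monoˡ (y ↪ z) x≤y) (↪-eval y z))

  ↪-monoʳ : ∀ z {x y} → x ≤ y → z ↪ x ≤ z ↪ y
  ↪-monoʳ z {x} {y} x≤y = ↪-intro z _ y (≤-trans (↪-eval z x) x≤y)

-- Only the →-halves of the three filter notions are treated here; the
-- ↪-halves are obtained by instantiating with the opposite monoid.
module Filter (M : ResiduatedMonoid) (F : ResiduatedMonoid.Carrier M → Set)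
  (F-up : ∀ {x y} → ResiduatedMonoid._≤_ M x y → F x → F y)
  (F-⊙ : ∀ {x y} → F x → F y → F (ResiduatedMonoid._⊙_ M x y))
  (F-⇒→↪ : ∀ {x y} → F (ResiduatedMonoid._⇒_ M x y) → F (ResiduatedMonoid._↪_ M x y))
  (F-↪→⇒ : ∀ {x y} → F (ResiduatedMonoid._↪_ M x y) → F (ResiduatedMonoid._⇒_ M x y))
  where
  open ResiduatedMonoid M
  open ResiduatedMonoidProperties M

  ⇒-Implicative ⇒-MV ⇒-G ↪-G : Set
  ⇒-Implicative = ∀ x y → F ((x ⇒ y) ↪ x) → F x
  ⇒-MV = ∀ x y → F (x ⇒ y) → F (((y ⇒ x) ↪ x) ⇒ y)
  ⇒-G = ∀ x y → F (x ⇒ (x ⇒ y)) → F (x ⇒ y)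
  ↪-G = ∀ x y → F (x ↪ (x ↪ y)) → F (x ↪ y)

  modus-ponens : ∀ {x y} → F x → F (x ⇒ y) → F y
  modus-ponens {x} {y} Fx Fx⇒y = F-up (⇒-eval x y) (F-⊙ Fx⇒y Fx)

  ⇒-implicative→⇒-G : ⇒-Implicative → ⇒-G
  ⇒-implicative→⇒-G implicative x y F[x⇒x⇒y] =
    implicative (x ⇒ y) y (F-up ≤-implicative-premise F[x⇒x⇒y])
    where
    ≤-implicative-premise : x ⇒ (x ⇒ y) ≤ ((x ⇒ y) ⇒ y) ↪ (x ⇒ y)
    ≤-implicative-premise = ↪-intro _ _ _ (⇒-intro _ x y
      (subst (_≤ y) (sym (assoc _ _ x))
        (≤-trans (⊙-monoʳ _ (⇒-eval x (x ⇒ y))) (⇒-eval (x ⇒ y) y))))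

  ⇒-implicative→⇒-MV : ⇒-Implicative → ⇒-MV
  ⇒-implicative→⇒-MV implicative x y F[x⇒y] =
    implicative m x (F-⇒→↪ (F-up ≤-implicative-premise F[x⇒y]))
    where
    u = (y ⇒ x) ↪ x
    m = u ⇒ y
    [m⇒x]⊙u≤x : (m ⇒ x) ⊙ u ≤ x
    [m⇒x]⊙u≤x = ≤-trans (⊙-monoˡ u (⇒-antitoneˡ x (≤-⇒ u y))) (↪-eval (y ⇒ x) x)
    ≤-implicative-premise : x ⇒ y ≤ (m ⇒ x) ⇒ m
    ≤-implicative-premise = ⇒-intro _ _ m (⇒-intro _ u y
      (subst (_≤ y) (sym (assoc _ _ u))
        (≤-trans (⊙-monoʳ _ [m⇒x]⊙u≤x) (⇒-eval x y))))

  ⇒-MV→↪-G→⇒-implicative : ⇒-MV → ↪-G → ⇒-Implicative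
  ⇒-MV→↪-G→⇒-implicative mv g x y F[[x⇒y]↪x] = modus-ponens F[a↪y] F[[a↪y]⇒x]
    where
    a = x ⇒ y
    F[y⇒x] : F (y ⇒ x)
    F[y⇒x] = F-↪→⇒ (F-up (↪-antitoneˡ x (≤-⇒ x y)) F[[x⇒y]↪x])
    F[[a↪y]⇒x] : F ((a ↪ y) ⇒ x)
    F[[a↪y]⇒x] = mv y x F[y⇒x]
    F[a↪y] : F (a ↪ y)
    F[a↪y] = g a y (F-up (↪-monoʳ a (↪-intro a x y (⇒-eval x y))) F[[x⇒y]↪x])

module IntervalProperties (R : RealField) where
  open RealField R
  open IsCommutativeRing isCommutativeRing
    using (+-comm; +-assoc; +-identityˡ; +-identityʳ; -‿inverseʳ; isRing)
  open Interval R

  ring : Ring _ _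
  ring = record { isRing = isRing }
  open RingProperties ring using (-1*x≈-x; -‿involutive)

  +-cancelʳ-≤ : ∀ {x y} z → x + z ≤ y + z → x ≤ y
  +-cancelʳ-≤ {x} {y} z x+z≤y+z = subst₂ _≤_ (+z-z x) (+z-z y) (+-mono-≤ (- z) x+z≤y+z)
    where
    +z-z : ∀ w → w + z + - z ≡ w
    +z-z w = trans (+-assoc w z (- z)) (trans (cong₂ _+_ refl (-‿inverseʳ z)) (+-identityʳ w))

  0≤1 : 0ℝ ≤ 1ℝ
  0≤1 with ≤-total 0ℝ 1ℝ
  ... | inj₁ 0≤1 = 0≤1
  ... | inj₂ 1≤0 = subst (0ℝ ≤_) [-1]*[-1]≡1 (*-nonneg 0≤-1 0≤-1)
    where
    0≤-1 : 0ℝ ≤ - 1ℝ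
    0≤-1 = subst₂ _≤_ (-‿inverseʳ 1ℝ) (+-identityˡ (- 1ℝ)) (+-mono-≤ (- 1ℝ) 1≤0)
    [-1]*[-1]≡1 : - 1ℝ * - 1ℝ ≡ 1ℝ
    [-1]*[-1]≡1 = trans (-1*x≈-x (- 1ℝ)) (-‿involutive 1ℝ)

  0≤½ : 0ℝ ≤ ½
  0≤½ with ≤-total 0ℝ ½
  ... | inj₁ 0≤½ = 0≤½
  ... | inj₂ ½≤0 = ⊥-elim (0≢1 (≤-antisym 0≤1 1≤0))
    where
    1≤0 : 1ℝ ≤ 0ℝ
    1≤0 = ≤-trans (subst₂ _≤_ ½+½ refl (+-mono-≤ ½ ½≤0))
                  (subst (_≤ 0ℝ) (sym (+-identityˡ ½)) ½≤0)

  ½≤1 : ½ ≤ 1ℝ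
  ½≤1 = subst₂ _≤_ (+-identityˡ ½) ½+½ (+-mono-≤ ½ 0≤½)

  1≤x+y⇒y≤½⇒y≤x : ∀ {x y} → 1ℝ ≤ x + y → y ≤ ½ → y ≤ x
  1≤x+y⇒y≤½⇒y≤x {x} {y} 1≤x+y y≤½ = ≤-trans y≤½ (+-cancelʳ-≤ y (≤-trans ½+y≤1 1≤x+y))
    where
    ½+y≤1 : ½ + y ≤ 1ℝ
    ½+y≤1 = subst₂ _≤_ (+-comm y ½) ½+½ (+-mono-≤ ½ y≤½)

  min-≤ˡ : ∀ x y → min x y ≤ x
  min-≤ˡ x y with x ≤? y
  ... | yes _ = ≤-refl x
  ... | no x≰y with ≤-total x y
  ...   | inj₁ x≤y = ⊥-elim (x≰y x≤y)
  ...   | inj₂ y≤x = y≤x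

  min-≤ʳ : ∀ x y → min x y ≤ y
  min-≤ʳ x y with x ≤? y
  ... | yes x≤y = x≤y
  ... | no _ = ≤-refl y

  min-glb : ∀ {x y z} → z ≤ x → z ≤ y → z ≤ min x y
  min-glb {x} {y} z≤x z≤y with x ≤? y
  ... | yes _ = z≤x
  ... | no _ = z≤y

  min-idem : ∀ x → min x x ≡ x
  min-idem x with x ≤? x
  ... | yes _ = refl
  ... | no _ = refl

  ≤ᵢ-trans : ∀ {a b c} → a ≤ᵢ b → b ≤ᵢ c → a ≤ᵢ c
  ≤ᵢ-trans (lo≤ , hi≤) (lo≤′ , hi≤′) = ≤-trans lo≤ lo≤′ , ≤-trans hi≤ hi≤′

  rmin-≤ˡ : ∀ a b → rmin a b ≤ᵢ a
  rmin-≤ˡ a b = min-≤ˡ _ _ , min-≤ˡ _ _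

  rmin-≤ʳ : ∀ a b → rmin a b ≤ᵢ b
  rmin-≤ʳ a b = min-≤ʳ _ _ , min-≤ʳ _ _

  rmin-glb : ∀ {a b c} → c ≤ᵢ a → c ≤ᵢ b → c ≤ᵢ rmin a b
  rmin-glb (lo≤ , hi≤) (lo≤′ , hi≤′) = min-glb lo≤ lo≤′ , min-glb hi≤ hi≤′

  rmin-idem : ∀ a → rmin a a ≡ a
  rmin-idem a = cong₂ [_,_] (min-idem (lo a)) (min-idem (hi a))

  InD-rmin : ∀ {a b} → InD a → InD b → InD (rmin a b)
  InD-rmin (0≤a , a≤a , a≤1) (0≤b , b≤b , _) =
    min-glb 0≤a 0≤b ,
    min-glb (≤-trans (min-≤ˡ _ _) a≤a) (≤-trans (min-≤ʳ _ _) b≤b) ,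
    ≤-trans (min-≤ˡ _ _) a≤1

  InD-½ : InD ½ᵢ
  InD-½ = 0≤½ , ≤-refl ½ , ½≤1

  ≐𝟘ᵢ⊎NonZero : ∀ {a} → InD a → a ≐ᵢ 𝟘ᵢ ⊎ NonZero a
  ≐𝟘ᵢ⊎NonZero {a} (0≤lo , lo≤hi , _) with hi a ≤? 0ℝ
  ... | yes hi≤0 = inj₁ (≤-antisym (≤-trans lo≤hi hi≤0) 0≤lo , ≤-antisym hi≤0 (≤-trans 0≤lo lo≤hi))
  ... | no hi≰0 = inj₂ λ (_ , hi≡0) → hi≰0 (subst (_≤ 0ℝ) (sym hi≡0) (≤-refl 0ℝ))

  ≐𝟘ᵢ⇒≤ᵢ : ∀ {a b} → a ≐ᵢ 𝟘ᵢ → InD b → a ≤ᵢ b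
  ≐𝟘ᵢ⇒≤ᵢ (lo≡0 , hi≡0) (0≤lo , lo≤hi , _) =
    subst (_≤ _) (sym lo≡0) 0≤lo , subst (_≤ _) (sym hi≡0) (≤-trans 0≤lo lo≤hi)

module Cuts (R : RealField) (A : PseudoBL) (μ : PseudoBL.Carrier A → Interval.IPair R)
  (μ-InD : Fuzzy.ValuedInD R A μ) (μ-filter : Fuzzy.IsFilter R A μ) where
  open Fuzzy R A
  open IntervalProperties R
  open PseudoBL A using (Carrier; _≤_; _⊙_)

  Cut : IPair → Set
  Cut t = InD t × t ≤ᵢ ½ᵢ

  Level : IPair → Carrier → Set
  Level t x = ∈F μ x t

  ∈∨q⇒∈ : ∀ {t x} → Cut t → (NonZero t → ∈∨qF μ x t) → ∈F μ x t
  ∈∨q⇒∈ {t} {x} (t-InD , t≤½) ∈∨q with ≐𝟘ᵢ⊎NonZero t-InD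
  ... | inj₁ t≐𝟘 = ≐𝟘ᵢ⇒≤ᵢ t≐𝟘 (μ-InD x)
  ... | inj₂ t≠𝟘 with ∈∨q t≠𝟘
  ...   | inj₁ ∈ = ∈
  ...   | inj₂ ((1≤lo , 1≤hi) , _) =
          1≤x+y⇒y≤½⇒y≤x 1≤lo (proj₁ t≤½) , 1≤x+y⇒y≤½⇒y≤x 1≤hi (proj₂ t≤½)

  Level-up : ∀ {t x y} → Cut t → x ≤ y → Level t x → Level t y
  Level-up {t} {x} {y} c x≤y ∈x = ∈∨q⇒∈ c λ t≠𝟘 → proj₂ μ-filter t x y (proj₁ c) t≠𝟘 x≤y ∈x

  Level-⊙ : ∀ {t x y} → Cut t → Level t x → Level t y → Level t (x ⊙ y)
  Level-⊙ {t} {x} {y} c ∈x ∈y = ∈∨q⇒∈ c λ t≠𝟘 →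
    subst (∈∨qF μ (x ⊙ y)) (rmin-idem t) (proj₁ μ-filter t t x y (proj₁ c) (proj₁ c) t≠𝟘 t≠𝟘 ∈x ∈y)

  rmin½-≤ᵢ⇔cutwise : ∀ {a b} → rmin (μ a) ½ᵢ ≤ᵢ μ b ⇔ (∀ {t} → Cut t → Level t a → Level t b)
  rmin½-≤ᵢ⇔cutwise {a} = mk⇔
    (λ ≤μb {_} (_ , t≤½) ∈a → ≤ᵢ-trans (rmin-glb ∈a t≤½) ≤μb)
    (λ cutwise → cutwise (InD-rmin (μ-InD a) InD-½ , rmin-≤ʳ _ _) (rmin-≤ˡ _ _))

module FuzzyFilter (R : RealField) (A : PseudoBL) (μ : PseudoBL.Carrier A → Interval.IPair R)
  (μ-InD : Fuzzy.ValuedInD R A μ) (μ-filter : Fuzzy.IsFilter R A μ)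
  (μ-⇒≡↪ : ∀ x y → μ (PseudoBL._⇒_ A x y) ≡ μ (PseudoBL._↪_ A x y)) where
  open Fuzzy R A
  open Cuts R A μ μ-InD μ-filter
  open Equivalence using (to; from)

  Level-⇒→↪ : ∀ {t x y} → Level t (PseudoBL._⇒_ A x y) → Level t (PseudoBL._↪_ A x y)
  Level-⇒→↪ {t} {x} {y} = subst (t ≤ᵢ_) (μ-⇒≡↪ x y)

  Level-↪→⇒ : ∀ {t x y} → Level t (PseudoBL._↪_ A x y) → Level t (PseudoBL._⇒_ A x y)
  Level-↪→⇒ {t} {x} {y} = subst (t ≤ᵢ_) (sym (μ-⇒≡↪ x y))

  module →Half {t} (c : Cut t) =
    Filter (residuatedMonoid A) (Level t) (Level-up c) (Level-⊙ c) Level-⇒→↪ Level-↪→⇒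
  module ↪Half {t} (c : Cut t) =
    Filter (op (residuatedMonoid A)) (Level t) (Level-up c) (λ ∈x ∈y → Level-⊙ c ∈y ∈x)
      Level-↪→⇒ Level-⇒→↪

  cutwise-implicative : IsImplicative μ →
    ∀ {t} (c : Cut t) → →Half.⇒-Implicative c × ↪Half.⇒-Implicative c
  cutwise-implicative imp c =
    (λ x y → to rmin½-≤ᵢ⇔cutwise (proj₁ (imp x y)) c) ,
    (λ x y → to rmin½-≤ᵢ⇔cutwise (proj₂ (imp x y)) c)

  implicative⇒MV : IsImplicative μ → IsMV μ
  implicative⇒MV imp x y =
    from rmin½-≤ᵢ⇔cutwise (λ c → →Half.⇒-implicative→⇒-MV c (proj₁ (cutwise-implicative imp c)) x y) ,
    from rmin½-≤ᵢ⇔cutwise (λ c → ↪Half.⇒-implicative→⇒-MV c (proj₂ (cutwise-implicative imp c)) x y)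

  implicative⇒G : IsImplicative μ → IsG μ
  implicative⇒G imp x y =
    from rmin½-≤ᵢ⇔cutwise (λ c → →Half.⇒-implicative→⇒-G c (proj₁ (cutwise-implicative imp c)) x y) ,
    from rmin½-≤ᵢ⇔cutwise (λ c → ↪Half.⇒-implicative→⇒-G c (proj₂ (cutwise-implicative imp c)) x y)

  MV⇒G⇒implicative : IsMV μ → IsG μ → IsImplicative μ
  MV⇒G⇒implicative mv g x y =
    from rmin½-≤ᵢ⇔cutwise (λ c → →Half.⇒-MV→↪-G→⇒-implicative c
      (λ a b → to rmin½-≤ᵢ⇔cutwise (proj₁ (mv a b)) c)
      (λ a b → to rmin½-≤ᵢ⇔cutwise (proj₂ (g a b)) c) x y) ,
    from rmin½-≤ᵢ⇔cutwise (λ c → ↪Half.⇒-MV→↪-G→⇒-implicative c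
      (λ a b → to rmin½-≤ᵢ⇔cutwise (proj₂ (mv a b)) c)
      (λ a b → to rmin½-≤ᵢ⇔cutwise (proj₁ (g a b)) c) x y)

theorem4p10 : (R : RealField) (A : PseudoBL)
              (μ : PseudoBL.Carrier A → Interval.IPair R) →
              Fuzzy.ValuedInD R A μ →
              Fuzzy.Standing R A μ →
              Fuzzy.IsFilter R A μ →
              (∀ x y → μ (PseudoBL._⇒_ A x y) ≡ μ (PseudoBL._↪_ A x y)) →
              Fuzzy.IsImplicative R A μ ⇔ (Fuzzy.IsMV R A μ × Fuzzy.IsG R A μ)
theorem4p10 R A μ μ-InD _ μ-filter μ-⇒≡↪ =
  mk⇔ (λ imp → implicative⇒MV imp , implicative⇒G imp)
      (λ (mv , g) → MV⇒G⇒implicative mv g)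
  where open FuzzyFilter R A μ μ-InD μ-filter μ-⇒≡↪
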